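{- Let $X=\{a_1,\dots,a_n\}$, let $\mathcal{F}$ be a union-closed family of subsets of $X$ with $\bigcup_{f\in\mathcal{F}}f=X$, let $w=a_1\cdots a_n$, and let $f\in\mathcal{F}$. If $t$ belongs to the $i$-section $\mathcal{F}_i$ for some $1\le i\le n$, then $t\cup f\in\mathcal{F}_i$.
   Context: Union-closed: $f,g\in\mathcal{F}\Rightarrow f\cup g\in\mathcal{F}$. Rising functions: for $T\subseteq 2^X$ and $a\in X$, $\varphi_{T,a}(z)=z\cup\{a\}$ if $z\cup\{a\}\notin T$, and $\varphi_{T,a}(z)=z$ otherwise. Put $\varphi_0=\mathrm{id}$, $\mathcal{F}_0=\mathcal{F}$, and for $1\le j\le n$, $\varphi_j=\varphi_{\mathcal{F}_{j-1},a_j}\circ\varphi_{j-1}$ and $\mathcal{F}_j=\varphi_j(\mathcal{F})=\varphi_{\mathcal{F}_{j-1},a_j}(\mathcal{F}_{j-1})$; $\mathcal{F}_j$ is called the $j$-section. -}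

module Defs where

open import Data.Nat using (ℕ)
open import Data.Bool using (Bool; if_then_else_)
import Data.Bool.Properties as BoolP
open import Data.Fin using (Fin)
open import Data.Fin.Subset using (Subset; _∪_; ⁅_⁆)
open import Data.List using (List; map; foldl; take; allFin)
open import Data.List.Membership.Propositional using (_∈_)
open import Data.Vec.Properties using (≡-dec)
open import Relation.Binary.Definitions using (DecidableEquality)
open import Relation.Nullary.Decidable using (does)
import Data.List.Membership.DecPropositional as DecMem

-- Ground set X = {a_1,...,a_n} is modelled as Fin n, with a_j the (j-1)-th
-- element of Fin n; the word w = a_1 ... a_n is the list allFin n.
-- A family of subsets of X is a finite list of subsets (membership via _∈_;
-- duplicates are irrelevant for membership).

Family : ℕ → Set
Family n = List (Subset n)

_≟S_ : ∀ {n} → DecidableEquality (Subset n)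
_≟S_ = ≡-dec BoolP._≟_

inFamily : ∀ {n} → Subset n → Family n → Bool
inFamily {n} z T = does (z ∈? T)
  where open DecMem (_≟S_ {n}) using (_∈?_)

UnionClosed : ∀ {n} → Family n → Set
UnionClosed F = ∀ {f g} → f ∈ F → g ∈ F → (f ∪ g) ∈ F

rising : ∀ {n} → Family n → Fin n → Subset n → Subset n
rising T a z = if inFamily (z ∪ ⁅ a ⁆) T then z else (z ∪ ⁅ a ⁆)

step : ∀ {n} → Family n → Fin n → Family n
step T a = map (rising T a) T

section : ∀ {n} → Family n → ℕ → Family n
section {n} F j = foldl step F (take j (allFin n))

module Submission where

-- Say that a family T ABSORBS F when t ∪ f ∈ T for all t ∈ T, f ∈ F.
-- A union-closed family F absorbs itself, and absorption by F is preserved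
-- by every rising step T ↦ φ_{T,a}(T), whatever T, F and a are.  Since the
-- i-section is obtained from F by i rising steps, it absorbs F, which is
-- the theorem.
--
-- Preservation under one step: let t ∈ T and f ∈ F.  If t ∪ {a} ∈ T, then
-- φ fixes t, and (t ∪ f) ∪ {a} = (t ∪ {a}) ∪ f ∈ T, so φ also fixes the
-- member t ∪ f of T.  Otherwise φ(t) = t ∪ {a} and φ(t) ∪ f = (t ∪ f) ∪ {a};
-- this is φ(t ∪ f) when (t ∪ f) ∪ {a} ∉ T, and when it lies in T it is
-- fixed by φ, being closed under adding a.

open import Defs
open import Data.Nat using (ℕ; _≤_)
open import Data.Fin using (Fin)
open import Data.Fin.Subset using (Subset; _∪_; ⋃; ⊤; ⁅_⁆)
open import Data.Fin.Subset.Properties using (∪-assoc; ∪-comm; ∪-idem)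
open import Data.List using (List; []; _∷_; foldl; take; allFin)
open import Data.List.Membership.Propositional using (_∈_; _∉_)
open import Data.List.Membership.Propositional.Properties using (∈-map⁺; ∈-map⁻)
open import Data.Product using (_,_)
open import Relation.Binary.PropositionalEquality
  using (_≡_; refl; sym; cong; subst; module ≡-Reasoning)
open import Relation.Nullary using (Dec; yes; no)
open import Relation.Nullary.Decidable using (dec-true; dec-false)
import Data.List.Membership.DecPropositional as DecMem

module _ {n : ℕ} where
  open DecMem (_≟S_ {n}) using (_∈?_)

  rising-fixes : (T : Family n) (a : Fin n) (z : Subset n) →
    (z ∪ ⁅ a ⁆) ∈ T → rising T a z ≡ z
  rising-fixes T a z z+a∈T rewrite dec-true ((z ∪ ⁅ a ⁆) ∈? T) z+a∈T = refl

  rising-adds : (T : Family n) (a : Fin n) (z : Subset n) →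
    (z ∪ ⁅ a ⁆) ∉ T → rising T a z ≡ z ∪ ⁅ a ⁆
  rising-adds T a z z+a∉T rewrite dec-false ((z ∪ ⁅ a ⁆) ∈? T) z+a∉T = refl

  rising-∈-step : (T : Family n) (a : Fin n) {z : Subset n} →
    z ∈ T → rising T a z ∈ step T a
  rising-∈-step T a = ∈-map⁺ (rising T a)

  fixed-∈-step : (T : Family n) (a : Fin n) {z : Subset n} →
    z ∈ T → (z ∪ ⁅ a ⁆) ∈ T → z ∈ step T a
  fixed-∈-step T a {z} z∈T z+a∈T =
    subst (_∈ step T a) (rising-fixes T a z z+a∈T) (rising-∈-step T a z∈T)

  ∪-add-swap : (t f : Subset n) (a : Fin n) →
    (t ∪ f) ∪ ⁅ a ⁆ ≡ (t ∪ ⁅ a ⁆) ∪ f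
  ∪-add-swap t f a = begin
    (t ∪ f) ∪ ⁅ a ⁆   ≡⟨ ∪-assoc t f ⁅ a ⁆ ⟩
    t ∪ (f ∪ ⁅ a ⁆)   ≡⟨ cong (t ∪_) (∪-comm f ⁅ a ⁆) ⟩
    t ∪ (⁅ a ⁆ ∪ f)   ≡⟨ sym (∪-assoc t ⁅ a ⁆ f) ⟩
    (t ∪ ⁅ a ⁆) ∪ f   ∎
    where open ≡-Reasoning

  ∪-add-idem : (s : Subset n) (a : Fin n) → (s ∪ ⁅ a ⁆) ∪ ⁅ a ⁆ ≡ s ∪ ⁅ a ⁆
  ∪-add-idem s a = begin
    (s ∪ ⁅ a ⁆) ∪ ⁅ a ⁆   ≡⟨ ∪-assoc s ⁅ a ⁆ ⁅ a ⁆ ⟩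
    s ∪ (⁅ a ⁆ ∪ ⁅ a ⁆)   ≡⟨ cong (s ∪_) (∪-idem ⁅ a ⁆) ⟩
    s ∪ ⁅ a ⁆             ∎
    where open ≡-Reasoning

  Absorbs : Family n → Family n → Set
  Absorbs T F = ∀ {t f} → t ∈ T → f ∈ F → (t ∪ f) ∈ T

  step-absorbs : (T F : Family n) (a : Fin n) →
    Absorbs T F → Absorbs (step T a) F
  step-absorbs T F a absorbs {f = f} t'∈ f∈F with ∈-map⁻ (rising T a) t'∈
  ... | t , t∈T , refl = by-cases ((t ∪ ⁅ a ⁆) ∈? T)
    where
      tf∈T : (t ∪ f) ∈ T
      tf∈T = absorbs t∈T f∈F

      by-cases : Dec ((t ∪ ⁅ a ⁆) ∈ T) → (rising T a t ∪ f) ∈ step T a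
      by-cases (yes t+a∈T) =
        subst (λ s → (s ∪ f) ∈ step T a) (sym (rising-fixes T a t t+a∈T))
          (fixed-∈-step T a tf∈T tf+a∈T)
        where
          tf+a∈T : ((t ∪ f) ∪ ⁅ a ⁆) ∈ T
          tf+a∈T = subst (_∈ T) (sym (∪-add-swap t f a)) (absorbs t+a∈T f∈F)
      by-cases (no t+a∉T) = subst (_∈ step T a) lifted-is-image
          (tf+a∈step (((t ∪ f) ∪ ⁅ a ⁆) ∈? T))
        where
          lifted-is-image : (t ∪ f) ∪ ⁅ a ⁆ ≡ rising T a t ∪ f
          lifted-is-image = begin
            (t ∪ f) ∪ ⁅ a ⁆    ≡⟨ ∪-add-swap t f a ⟩
            (t ∪ ⁅ a ⁆) ∪ f    ≡⟨ cong (_∪ f) (sym (rising-adds T a t t+a∉T)) ⟩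
            rising T a t ∪ f   ∎
            where open ≡-Reasoning

          tf+a∈step : Dec (((t ∪ f) ∪ ⁅ a ⁆) ∈ T) → ((t ∪ f) ∪ ⁅ a ⁆) ∈ step T a
          tf+a∈step (yes tf+a∈T) =
            fixed-∈-step T a tf+a∈T
              (subst (_∈ T) (sym (∪-add-idem (t ∪ f) a)) tf+a∈T)
          tf+a∈step (no tf+a∉T) =
            subst (_∈ step T a) (rising-adds T a (t ∪ f) tf+a∉T)
              (rising-∈-step T a tf∈T)

  steps-absorb : (T F : Family n) (ws : List (Fin n)) →
    Absorbs T F → Absorbs (foldl step T ws) F
  steps-absorb T F []       absorbs = absorbs
  steps-absorb T F (a ∷ ws) absorbs =
    steps-absorb (step T a) F ws (step-absorbs T F a absorbs)

lemma3p3 : (n : ℕ) (F : Family n) → UnionClosed F → ⋃ F ≡ ⊤ →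
    (f : Subset n) → f ∈ F →
    (i : ℕ) → 1 ≤ i → i ≤ n →
    (t : Subset n) → t ∈ section F i → (t ∪ f) ∈ section F i
lemma3p3 n F unionClosed _ f f∈F i _ _ t t∈Fᵢ =
  steps-absorb F F (take i (allFin n)) unionClosed t∈Fᵢ f∈F
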